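{- For any $n$, the number of partitions of $n$ with an odd number of even hooks is even.
   Context: For a cell $(i,j)$ of the Young diagram of a partition $\lambda$ (with conjugate $\lambda'$), its hook length is $\lambda_i-j+\lambda'_j-i+1$. An even hook is a cell whose hook length is even; the number of even hooks of $\lambda$ is the number of such cells. -}

module Defs where

open import Data.Nat using (ℕ; zero; suc; _+_; _∸_; _≤_; _<_; _≥_; _≤?_; _%_)
open import Data.Nat.Properties using (_≟_)
open import Data.Nat.ListAction using (sum)
open import Data.List using (List; []; _∷_; length; filter; upTo; lookup; map; concatMap; foldr)
open import Data.List.Relation.Unary.All using (All)
open import Data.List.Relation.Unary.Linked using (Linked)
open import Data.Fin using (Fin; toℕ)
open import Data.Product using (_×_)
open import Relation.Binary.PropositionalEquality using (_≡_)
open import Relation.Nullary.Decidable using (Dec; yes; no)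

IsPartition : ℕ → List ℕ → Set
IsPartition n ps = All (λ p → 1 ≤ p) ps × Linked _≥_ ps × sum ps ≡ n

-- Row lengths with 1-based indexing: rowLen λ i = λ_i (0 if i exceeds the length).
rowLen : List ℕ → ℕ → ℕ
rowLen []       _             = 0
rowLen (p ∷ ps) zero          = 0
rowLen (p ∷ ps) (suc zero)    = p
rowLen (p ∷ ps) (suc (suc i)) = rowLen ps (suc i)

colLen : List ℕ → ℕ → ℕ
colLen []       j = 0
colLen (p ∷ ps) j with j ≤? p
... | yes _ = suc (colLen ps j)
... | no  _ = colLen ps j

-- Hook length of cell (i,j) (1-based, cell in the diagram: j ≤ λ_i, i ≤ λ'_j):
-- λ_i - j + λ'_j - i + 1.
hookLength : List ℕ → ℕ → ℕ → ℕ
hookLength ps i j = suc ((rowLen ps i ∸ j) + (colLen ps j ∸ i))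

cellsRow : ℕ → ℕ → List (ℕ × ℕ)
cellsRow i p = map (λ j → (i Data.Product., suc j)) (upTo p)

cellsFrom : ℕ → List ℕ → List (ℕ × ℕ)
cellsFrom i []       = []
cellsFrom i (p ∷ ps) = cellsRow i p Data.List.++ cellsFrom (suc i) ps

cells : List ℕ → List (ℕ × ℕ)
cells ps = cellsFrom 1 ps

isEven : ℕ → Set
isEven m = m % 2 ≡ 0

isOdd : ℕ → Set
isOdd m = m % 2 ≡ 1

evenHooks : List ℕ → ℕ
evenHooks ps = length (filter (λ c → (hookLength ps (Data.Product.proj₁ c) (Data.Product.proj₂ c) % 2) ≟ 0) (cells ps))

countOddEvenHooks : List (List ℕ) → ℕ
countOddEvenHooks L = length (filter (λ ps → (evenHooks ps % 2) ≟ 1) L)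

-- Transposition of Young diagrams is an involution on the partitions of n which maps hooks
-- to hooks of the same length, so it preserves the number of even hooks; the partitions with
-- an odd number of even hooks therefore fall into conjugate pairs, except possibly the
-- self-conjugate ones. A self-conjugate partition, however, has an even number of even hooks:
-- its diagonal hooks have odd length 2(λᵢ - i) + 1, and the off-diagonal hooks come in
-- mirror-image pairs.
module Submission where

open import Data.Nat using (ℕ; zero; suc; _+_; _*_; _∸_; _%_; _≤_; _<_; _≥_; _≤?_; s≤s; z≤n)
open import Data.Nat.Properties
  using (_≟_; +-0-commutativeMonoid; +-comm; +-assoc; +-suc; +-identityʳ; *-comm;
         ≤-refl; ≤-trans; <⇒≱; +-mono-≤; m≤m+n; m≤n+m; *-zeroʳ; ≰⇒>; 0≢1+n)
open import Data.Nat.Divisibility using (_∣_; divides; _∣0; ∣-refl; ∣m∣n⇒∣m+n; n∣m⇒m%n≡0)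
open import Data.Nat.Induction using (<-wellFounded)
open import Data.Nat.ListAction using (sum)
open import Data.Fin using (toℕ)
open import Data.List using (List; []; _∷_; _++_; length; filter; applyUpTo)
open import Data.List.Properties using (≡-dec; length-++; filter-++; filter-all; filter-accept; filter-reject; length-filter; map-upTo)
open import Data.List.Relation.Unary.All using (All; []; _∷_)
import Data.List.Relation.Unary.All as All
open import Data.List.Relation.Unary.All.Properties using (applyUpTo⁺₁)
open import Data.List.Relation.Unary.Any using (here; there)
open import Data.List.Relation.Unary.Linked using (Linked; []; [-]; _∷_)
import Data.List.Relation.Unary.Linked as Linked
open import Data.List.Relation.Unary.Linked.Properties using (Linked⇒All)
open import Data.List.Membership.Propositional using (_∈_)
open import Data.List.Membership.Propositional.Properties using (∈-filter⁺; ∈-filter⁻)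
open import Data.List.Relation.Unary.Unique.Propositional using (Unique; _∷_)
open import Data.List.Relation.Unary.Unique.Propositional.Properties using (filter⁺; Unique[x∷xs]⇒x∉xs)
open import Data.Product using (_×_; _,_; proj₁; proj₂)
open import Function using (_∘_; flip)
open import Function.Bundles using (_⇔_; mk⇔; Equivalence)
open import Induction.WellFounded using (Acc; acc)
open import Relation.Binary.Definitions using (DecidableEquality)
open import Relation.Binary.PropositionalEquality
open import Relation.Nullary using (¬_; Dec; yes; no; ¬?; contradiction)
open import Relation.Unary using (Pred; Decidable)
open import Level using (0ℓ)
open import Algebra.Properties.CommutativeMonoid.Sum +-0-commutativeMonoid as FinSum
  using (∑-comm; ∑-distrib-+; sum-cong-≗; sum-replicate-zero)

open import Defs

-- ℕ-indexed finite sums, defined through the library's Fin-indexed sums so that its lemmas apply.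
∑< : ℕ → (ℕ → ℕ) → ℕ
∑< n f = FinSum.sum {n} (f ∘ toℕ)

syntax ∑< n (λ i → e) = ∑[ i < n ] e

∑-cong : ∀ n {f g : ℕ → ℕ} → (∀ i → f i ≡ g i) → ∑< n f ≡ ∑< n g
∑-cong n f≗g = sum-cong-≗ {n} (f≗g ∘ toℕ)

∑-zero : ∀ n → ∑[ i < n ] 0 ≡ 0
∑-zero = sum-replicate-zero

∑-+ : ∀ n (f g : ℕ → ℕ) → ∑[ i < n ] (f i + g i) ≡ ∑< n f + ∑< n g
∑-+ n f g = ∑-distrib-+ {n} (f ∘ toℕ) (g ∘ toℕ)

∑-swap : ∀ m n (F : ℕ → ℕ → ℕ) → ∑[ i < m ] ∑[ j < n ] F i j ≡ ∑[ j < n ] ∑[ i < m ] F i j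
∑-swap m n F = ∑-comm {m} {n} (λ i j → F (toℕ i) (toℕ j))

⟦_≤_⟧ : ℕ → ℕ → ℕ
⟦ zero  ≤ r     ⟧ = 1
⟦ suc j ≤ zero  ⟧ = 0
⟦ suc j ≤ suc r ⟧ = ⟦ j ≤ r ⟧

⟦≤⟧-true : ∀ {j r} → j ≤ r → ⟦ j ≤ r ⟧ ≡ 1
⟦≤⟧-true {zero}  _         = refl
⟦≤⟧-true {suc j} (s≤s j≤r) = ⟦≤⟧-true j≤r

⟦≤⟧-false : ∀ {j r} → ¬ j ≤ r → ⟦ j ≤ r ⟧ ≡ 0
⟦≤⟧-false {zero}              j≰r = contradiction z≤n j≰r
⟦≤⟧-false {suc j} {zero}      _   = refl
⟦≤⟧-false {suc j} {suc r}     j≰r = ⟦≤⟧-false (j≰r ∘ s≤s)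

⟦≤⟧-cong : ∀ {a b c d} → a ≤ b ⇔ c ≤ d → ⟦ a ≤ b ⟧ ≡ ⟦ c ≤ d ⟧
⟦≤⟧-cong {a} {b} a≤b⇔c≤d with a ≤? b
... | yes a≤b = trans (⟦≤⟧-true a≤b) (sym (⟦≤⟧-true (Equivalence.to a≤b⇔c≤d a≤b)))
... | no  a≰b = trans (⟦≤⟧-false a≰b) (sym (⟦≤⟧-false (a≰b ∘ Equivalence.from a≤b⇔c≤d)))

⟦≤⟧-antitoneˡ : ∀ j r → ⟦ suc j ≤ r ⟧ ≤ ⟦ j ≤ r ⟧
⟦≤⟧-antitoneˡ zero    zero    = z≤n
⟦≤⟧-antitoneˡ zero    (suc r) = ≤-refl
⟦≤⟧-antitoneˡ (suc j) zero    = z≤n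
⟦≤⟧-antitoneˡ (suc j) (suc r) = ⟦≤⟧-antitoneˡ j r

𝟙 : ∀ {P : Set} → Dec P → ℕ
𝟙 (yes _) = 1
𝟙 (no  _) = 0

𝟙-no : ∀ {P : Set} (d : Dec P) → ¬ P → 𝟙 d ≡ 0
𝟙-no (yes p) ¬p = contradiction p ¬p
𝟙-no (no _)  _  = refl

∑-truncate : ∀ (f : ℕ → ℕ) q M → q ≤ M → ∑[ j < M ] (⟦ suc j ≤ q ⟧ * f j) ≡ ∑< q f
∑-truncate f zero    M       _         = ∑-zero M
∑-truncate f (suc q) (suc M) (s≤s q≤M) = cong₂ _+_ (+-identityʳ (f 0)) (∑-truncate (f ∘ suc) q M q≤M)

∑-count : ∀ q M → q ≤ M → ∑[ j < M ] ⟦ suc j ≤ q ⟧ ≡ q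
∑-count zero    M       _         = ∑-zero M
∑-count (suc q) (suc M) (s≤s q≤M) = cong suc (∑-count q M q≤M)

∑-applyUpTo : ∀ (g : ℕ → ℕ) m → sum (applyUpTo g m) ≡ ∑< m g
∑-applyUpTo g zero    = refl
∑-applyUpTo g (suc m) = cong (g 0 +_) (∑-applyUpTo (g ∘ suc) m)

2∣n+n : ∀ n → 2 ∣ n + n
2∣n+n n = divides n (trans (cong (n +_) (sym (+-identityʳ n))) (*-comm 2 n))

1+n+n%2≡1 : ∀ n → suc (n + n) % 2 ≡ 1
1+n+n%2≡1 zero    = refl
1+n+n%2≡1 (suc n) rewrite +-suc n n = 1+n+n%2≡1 n

∑∑-symmetric-even : ∀ m (G : ℕ → ℕ → ℕ) → (∀ i j → G i j ≡ G j i) → (∀ i → G i i ≡ 0) →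
                    2 ∣ ∑[ i < m ] ∑[ j < m ] G i j
∑∑-symmetric-even zero    G _         _    = 2 ∣0
∑∑-symmetric-even (suc m) G symmetric diag =
  subst (2 ∣_) (sym split) (∣m∣n⇒∣m+n (2∣n+n first) (∑∑-symmetric-even m G′ (λ i j → symmetric (suc i) (suc j)) (diag ∘ suc)))
  where
  G′ : ℕ → ℕ → ℕ
  G′ i j = G (suc i) (suc j)
  first rest : ℕ
  first = ∑[ j < m ] G 0 (suc j)
  rest  = ∑[ i < m ] ∑[ j < m ] G′ i j
  split : ∑[ i < suc m ] ∑[ j < suc m ] G i j ≡ (first + first) + rest
  split = begin
    (G 0 0 + first) + ∑[ i < m ] (G (suc i) 0 + ∑[ j < m ] G′ i j)
      ≡⟨ cong₂ _+_ (cong (_+ first) (diag 0)) (∑-+ m (λ i → G (suc i) 0) (λ i → ∑[ j < m ] G′ i j)) ⟩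
    first + (∑[ i < m ] G (suc i) 0 + rest)
      ≡⟨ cong (λ c → first + (c + rest)) (∑-cong m (λ i → symmetric (suc i) 0)) ⟩
    first + (first + rest)
      ≡⟨ +-assoc first first rest ⟨
    (first + first) + rest ∎
    where open ≡-Reasoning

record IsFixedPointFreeInvolutionOn {A : Set} (f : A → A) (xs : List A) : Set where
  field
    closed         : ∀ {x} → x ∈ xs → f x ∈ xs
    involutive     : ∀ {x} → x ∈ xs → f (f x) ≡ x
    fixedPointFree : ∀ {x} → x ∈ xs → f x ≢ x

open IsFixedPointFreeInvolutionOn

module _ {A : Set} (_≟ᴬ_ : DecidableEquality A) (f : A → A) where

  private
    _≢?_ : ∀ y a → Dec (y ≢ a)
    y ≢? a = ¬? (y ≟ᴬ a)

    remove : A → List A → List A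
    remove a = filter (_≢? a)

    length-remove : ∀ {a xs} → Unique xs → a ∈ xs → length xs ≡ suc (length (remove a xs))
    length-remove {a} {_ ∷ ys} (a∉ys ∷ _) (here refl) = cong (suc ∘ length) (begin
      ys                   ≡⟨ filter-all (_≢? a) (All.map (_∘ sym) a∉ys) ⟨
      remove a ys          ≡⟨ filter-reject (_≢? a) (λ a≢a → a≢a refl) ⟨
      remove a (a ∷ ys)    ∎)
      where open ≡-Reasoning
    length-remove {a} {y ∷ ys} u@(_ ∷ ys!) (there a∈ys) = begin
      suc (length ys)                  ≡⟨ cong suc (length-remove ys! a∈ys) ⟩
      suc (suc (length (remove a ys))) ≡⟨ cong (suc ∘ length) (filter-accept (_≢? a) y≢a) ⟨
      suc (length (remove a (y ∷ ys))) ∎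
      where
      open ≡-Reasoning
      y≢a : y ≢ a
      y≢a y≡a = Unique[x∷xs]⇒x∉xs u (subst (_∈ ys) (sym y≡a) a∈ys)

    2∣length-acc : ∀ xs → Acc _<_ (length xs) → Unique xs → IsFixedPointFreeInvolutionOn f xs → 2 ∣ length xs
    2∣length-acc []         _        _         _   = 2 ∣0
    2∣length-acc (x ∷ rest) (acc rs) u@(_ ∷ rest!) inv with closed inv (here refl)
    ... | here fx≡x = contradiction fx≡x (fixedPointFree inv (here refl))
    ... | there fx∈rest =
      subst (2 ∣_) (cong suc (sym (length-remove rest! fx∈rest)))
        (∣m∣n⇒∣m+n ∣-refl (2∣length-acc rest′ (rs (s≤s (length-filter _ rest))) (filter⁺ _ rest!) inv′))
      where
      rest′ : List A
      rest′ = remove (f x) rest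
      -- f y = x or f y = f x would force y ∈ {f x, x}, and both are excluded from rest′.
      closed′ : ∀ {y} → y ∈ rest′ → f y ∈ rest′
      closed′ {y} y∈rest′ with ∈-filter⁻ (_≢? f x) y∈rest′
      ... | y∈rest , y≢fx with closed inv (there y∈rest)
      ...   | here fy≡x     = contradiction (trans (sym (involutive inv (there y∈rest))) (cong f fy≡x)) y≢fx
      ...   | there fy∈rest = ∈-filter⁺ (_≢? f x) fy∈rest λ fy≡fx →
        Unique[x∷xs]⇒x∉xs u (subst (_∈ rest)
          (trans (sym (involutive inv (there y∈rest))) (trans (cong f fy≡fx) (involutive inv (here refl)))) y∈rest)
      inv′ : IsFixedPointFreeInvolutionOn f rest′
      inv′ = record
        { closed         = closed′
        ; involutive     = involutive inv ∘ there ∘ proj₁ ∘ ∈-filter⁻ (_≢? f x)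
        ; fixedPointFree = fixedPointFree inv ∘ there ∘ proj₁ ∘ ∈-filter⁻ (_≢? f x)
        }

  fixedPointFreeInvolution⇒2∣length : ∀ xs → Unique xs → IsFixedPointFreeInvolutionOn f xs → 2 ∣ length xs
  fixedPointFreeInvolution⇒2∣length xs = 2∣length-acc xs (<-wellFounded (length xs))

largestPart : List ℕ → ℕ
largestPart []      = 0
largestPart (p ∷ _) = p

conjugate : List ℕ → List ℕ
conjugate ps = applyUpTo (λ k → colLen ps (suc k)) (largestPart ps)

parts≤largestPart : ∀ {ps} → Linked _≥_ ps → All (_≤ largestPart ps) ps
parts≤largestPart {[]}    _   = []
parts≤largestPart {_ ∷ _} ps↓ = Linked⇒All (flip ≤-trans) ≤-refl ps↓

tail≤head : ∀ {p qs} → Linked _≥_ (p ∷ qs) → All (_≤ p) qs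
tail≤head = All.tail ∘ parts≤largestPart

rowLen≤ : ∀ {p} qs i → All (_≤ p) qs → rowLen qs i ≤ p
rowLen≤ []       _             _          = z≤n
rowLen≤ (_ ∷ _)  zero          _          = z≤n
rowLen≤ (_ ∷ _)  (suc zero)    (q≤p ∷ _)  = q≤p
rowLen≤ (_ ∷ qs) (suc (suc i)) (_ ∷ qs≤p) = rowLen≤ qs (suc i) qs≤p

colLen-∷ : ∀ p qs j → colLen (p ∷ qs) j ≡ ⟦ j ≤ p ⟧ + colLen qs j
colLen-∷ p qs j with j ≤? p
... | yes j≤p rewrite ⟦≤⟧-true j≤p  = refl
... | no  j≰p rewrite ⟦≤⟧-false j≰p = refl

colLen-beyond : ∀ {p x} qs → p < x → All (_≤ p) qs → colLen qs x ≡ 0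
colLen-beyond         []       _   _             = refl
colLen-beyond {x = x} (q ∷ qs) p<x (q≤p ∷ qs≤p) with x ≤? q
... | yes x≤q = contradiction (≤-trans x≤q q≤p) (<⇒≱ p<x)
... | no  _   = colLen-beyond qs p<x qs≤p

colLen-antitone : ∀ ps x → colLen ps (suc x) ≤ colLen ps x
colLen-antitone []       _ = z≤n
colLen-antitone (p ∷ qs) x rewrite colLen-∷ p qs x | colLen-∷ p qs (suc x) =
  +-mono-≤ (⟦≤⟧-antitoneˡ x p) (colLen-antitone qs x)

≤colLen⇒≤rowLen : ∀ {ps} → Linked _≥_ ps → ∀ i j → suc j ≤ colLen ps (suc i) → suc i ≤ rowLen ps (suc j)
≤colLen⇒≤rowLen {p ∷ qs} ps↓ i j       h       with suc i ≤? p
≤colLen⇒≤rowLen {p ∷ qs} ps↓ i zero    _       | yes i<p = i<p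
≤colLen⇒≤rowLen {p ∷ qs} ps↓ i (suc j) (s≤s h) | yes _   = ≤colLen⇒≤rowLen (Linked.tail ps↓) i j h
≤colLen⇒≤rowLen {p ∷ qs} ps↓ i j       h       | no  i≮p =
  contradiction (subst (suc j ≤_) (colLen-beyond qs (≰⇒> i≮p) (tail≤head ps↓)) h) λ ()

≤rowLen⇒≤colLen : ∀ {ps} → Linked _≥_ ps → ∀ i j → suc i ≤ rowLen ps (suc j) → suc j ≤ colLen ps (suc i)
≤rowLen⇒≤colLen {p ∷ qs} ps↓ i j       h with suc i ≤? p
≤rowLen⇒≤colLen {p ∷ qs} ps↓ i zero    _ | yes _   = s≤s z≤n
≤rowLen⇒≤colLen {p ∷ qs} ps↓ i (suc j) h | yes _   = s≤s (≤rowLen⇒≤colLen (Linked.tail ps↓) i j h)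
≤rowLen⇒≤colLen {p ∷ qs} ps↓ i zero    h | no  i≮p = contradiction h i≮p
≤rowLen⇒≤colLen {p ∷ qs} ps↓ i (suc j) h | no  i≮p =
  contradiction (≤-trans h (rowLen≤ qs (suc j) (tail≤head ps↓))) i≮p

≤colLen⇔≤rowLen : ∀ {ps} → Linked _≥_ ps → ∀ i j → suc j ≤ colLen ps (suc i) ⇔ suc i ≤ rowLen ps (suc j)
≤colLen⇔≤rowLen ps↓ i j = mk⇔ (≤colLen⇒≤rowLen ps↓ i j) (≤rowLen⇒≤colLen ps↓ i j)

rowLen-applyUpTo : ∀ (g : ℕ → ℕ) m i → rowLen (applyUpTo g m) (suc i) ≡ ⟦ suc i ≤ m ⟧ * g i
rowLen-applyUpTo g zero    i       = refl
rowLen-applyUpTo g (suc m) zero    = sym (+-identityʳ (g 0))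
rowLen-applyUpTo g (suc m) (suc i) = rowLen-applyUpTo (g ∘ suc) m i

colLen-applyUpTo : ∀ (g : ℕ → ℕ) m j → colLen (applyUpTo g m) j ≡ ∑[ k < m ] ⟦ j ≤ g k ⟧
colLen-applyUpTo g zero    j = refl
colLen-applyUpTo g (suc m) j =
  trans (colLen-∷ (g 0) _ j) (cong (⟦ j ≤ g 0 ⟧ +_) (colLen-applyUpTo (g ∘ suc) m j))

applyUpTo-linked : ∀ (g : ℕ → ℕ) m → (∀ k → g (suc k) ≤ g k) → Linked _≥_ (applyUpTo g m)
applyUpTo-linked g zero          _  = []
applyUpTo-linked g (suc zero)    _  = [-]
applyUpTo-linked g (suc (suc m)) g↓ = g↓ 0 ∷ applyUpTo-linked (g ∘ suc) (suc m) (g↓ ∘ suc)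

∑-colLen : ∀ ps M → All (_≤ M) ps → ∑[ k < M ] colLen ps (suc k) ≡ sum ps
∑-colLen []       M _            = ∑-zero M
∑-colLen (p ∷ qs) M (p≤M ∷ qs≤M) = begin
  ∑[ k < M ] colLen (p ∷ qs) (suc k)                         ≡⟨ ∑-cong M (colLen-∷ p qs ∘ suc) ⟩
  ∑[ k < M ] (⟦ suc k ≤ p ⟧ + colLen qs (suc k))             ≡⟨ ∑-+ M (λ k → ⟦ suc k ≤ p ⟧) (colLen qs ∘ suc) ⟩
  ∑[ k < M ] ⟦ suc k ≤ p ⟧ + ∑[ k < M ] colLen qs (suc k)    ≡⟨ cong₂ _+_ (∑-count p M p≤M) (∑-colLen qs M qs≤M) ⟩
  p + sum qs                                                 ∎
  where open ≡-Reasoning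

rowLen-conjugate : ∀ {ps} → Linked _≥_ ps → ∀ i → rowLen (conjugate ps) (suc i) ≡ colLen ps (suc i)
rowLen-conjugate {ps} ps↓ i rewrite rowLen-applyUpTo (λ k → colLen ps (suc k)) (largestPart ps) i
  with suc i ≤? largestPart ps
... | yes i<L rewrite ⟦≤⟧-true i<L  = +-identityʳ _
... | no  i≮L rewrite ⟦≤⟧-false i≮L = sym (colLen-beyond ps (≰⇒> i≮L) (parts≤largestPart ps↓))

colLen-conjugate : ∀ {ps} → Linked _≥_ ps → ∀ j → colLen (conjugate ps) (suc j) ≡ rowLen ps (suc j)
colLen-conjugate {ps} ps↓ j = begin
  colLen (conjugate ps) (suc j)                                ≡⟨ colLen-applyUpTo _ (largestPart ps) (suc j) ⟩
  ∑[ k < largestPart ps ] ⟦ suc j ≤ colLen ps (suc k) ⟧        ≡⟨ ∑-cong (largestPart ps) (λ k → ⟦≤⟧-cong (≤colLen⇔≤rowLen ps↓ k j)) ⟩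
  ∑[ k < largestPart ps ] ⟦ suc k ≤ rowLen ps (suc j) ⟧        ≡⟨ ∑-count _ (largestPart ps) (rowLen≤ ps (suc j) (parts≤largestPart ps↓)) ⟩
  rowLen ps (suc j)                                            ∎
  where open ≡-Reasoning

conjugate-isPartition : ∀ {n ps} → IsPartition n ps → IsPartition n (conjugate ps)
conjugate-isPartition {ps = []}         P                = P
conjugate-isPartition {n} {ps@(p ∷ qs)} (_ , ps↓ , Σps≡n) =
  applyUpTo⁺₁ _ p colLen-positive ,
  applyUpTo-linked _ p (colLen-antitone ps ∘ suc) ,
  (begin
    sum (conjugate ps)              ≡⟨ ∑-applyUpTo _ p ⟩
    ∑[ k < p ] colLen ps (suc k)    ≡⟨ ∑-colLen ps p (parts≤largestPart ps↓) ⟩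
    sum ps                          ≡⟨ Σps≡n ⟩
    n                               ∎)
  where
  open ≡-Reasoning
  colLen-positive : ∀ {k} → k < p → 1 ≤ colLen ps (suc k)
  colLen-positive {k} k<p with suc k ≤? p
  ... | yes _   = s≤s z≤n
  ... | no  k≮p = contradiction k<p k≮p

rowLen-injective : ∀ {xs ys} → All (1 ≤_) xs → All (1 ≤_) ys →
                   (∀ i → rowLen xs (suc i) ≡ rowLen ys (suc i)) → xs ≡ ys
rowLen-injective {[]}    {[]}    _         _         _  = refl
rowLen-injective {[]}    {_ ∷ _} _         (y>0 ∷ _) eq = contradiction (subst (1 ≤_) (sym (eq 0)) y>0) λ ()
rowLen-injective {_ ∷ _} {[]}    (x>0 ∷ _) _         eq = contradiction (subst (1 ≤_) (eq 0) x>0) λ ()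
rowLen-injective {_ ∷ _} {_ ∷ _} (_ ∷ xs>0) (_ ∷ ys>0) eq =
  cong₂ _∷_ (eq 0) (rowLen-injective xs>0 ys>0 (eq ∘ suc))

conjugate-involutive : ∀ {n ps} → IsPartition n ps → conjugate (conjugate ps) ≡ ps
conjugate-involutive P@(ps>0 , ps↓ , _) =
  rowLen-injective (proj₁ (conjugate-isPartition P′)) ps>0
    (λ i → trans (rowLen-conjugate (proj₁ (proj₂ P′)) i) (colLen-conjugate ps↓ i))
  where
  P′ = conjugate-isPartition P

hookLength-conjugate : ∀ {ps} → Linked _≥_ ps → ∀ i j →
                       hookLength (conjugate ps) (suc i) (suc j) ≡ hookLength ps (suc j) (suc i)
hookLength-conjugate {ps} ps↓ i j rewrite rowLen-conjugate ps↓ i | colLen-conjugate ps↓ j =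
  cong suc (+-comm (colLen ps (suc i) ∸ suc j) (rowLen ps (suc j) ∸ suc i))

module _ {P : Pred (ℕ × ℕ) 0ℓ} (P? : Decidable P) where

  length-filter-applyUpTo : ∀ (g : ℕ → ℕ × ℕ) m → length (filter P? (applyUpTo g m)) ≡ ∑[ k < m ] 𝟙 (P? (g k))
  length-filter-applyUpTo g zero    = refl
  length-filter-applyUpTo g (suc m) with P? (g 0)
  ... | yes _ = cong suc (length-filter-applyUpTo (g ∘ suc) m)
  ... | no  _ = length-filter-applyUpTo (g ∘ suc) m

  length-filter-cellsRow : ∀ i q M → q ≤ M →
                           length (filter P? (cellsRow i q)) ≡ ∑[ j < M ] (⟦ suc j ≤ q ⟧ * 𝟙 (P? (i , suc j)))
  length-filter-cellsRow i q M q≤M = begin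
    length (filter P? (cellsRow i q))                     ≡⟨ cong (length ∘ filter P?) (map-upTo _ q) ⟩
    length (filter P? (applyUpTo (λ j → (i , suc j)) q))  ≡⟨ length-filter-applyUpTo _ q ⟩
    ∑[ j < q ] 𝟙 (P? (i , suc j))                         ≡⟨ ∑-truncate (λ j → 𝟙 (P? (i , suc j))) q M q≤M ⟨
    ∑[ j < M ] (⟦ suc j ≤ q ⟧ * 𝟙 (P? (i , suc j)))        ∎
    where open ≡-Reasoning

  length-filter-cellsFrom : ∀ k qs N M → length qs ≤ N → All (_≤ M) qs →
                            length (filter P? (cellsFrom k qs))
                              ≡ ∑[ i < N ] ∑[ j < M ] (⟦ suc j ≤ rowLen qs (suc i) ⟧ * 𝟙 (P? (i + k , suc j)))
  length-filter-cellsFrom k []       N       M _         _            =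
    sym (trans (∑-cong N (λ _ → ∑-zero M)) (∑-zero N))
  length-filter-cellsFrom k (q ∷ qs) (suc N) M (s≤s ℓ≤N) (q≤M ∷ qs≤M) = begin
    length (filter P? (cellsRow k q ++ cellsFrom (suc k) qs))
      ≡⟨ cong length (filter-++ P? (cellsRow k q) _) ⟩
    length (filter P? (cellsRow k q) ++ filter P? (cellsFrom (suc k) qs))
      ≡⟨ length-++ (filter P? (cellsRow k q)) ⟩
    length (filter P? (cellsRow k q)) + length (filter P? (cellsFrom (suc k) qs))
      ≡⟨ cong₂ _+_ (length-filter-cellsRow k q M q≤M) (trans (length-filter-cellsFrom (suc k) qs N M ℓ≤N qs≤M) shift) ⟩
    ∑[ j < M ] (⟦ suc j ≤ q ⟧ * 𝟙 (P? (k , suc j))) + ∑[ i < N ] ∑[ j < M ] cell (suc i) j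
      ∎
    where
    open ≡-Reasoning
    cell : ℕ → ℕ → ℕ
    cell i j = ⟦ suc j ≤ rowLen (q ∷ qs) (suc i) ⟧ * 𝟙 (P? (i + k , suc j))
    shift : ∑[ i < N ] ∑[ j < M ] (⟦ suc j ≤ rowLen qs (suc i) ⟧ * 𝟙 (P? (i + suc k , suc j)))
          ≡ ∑[ i < N ] ∑[ j < M ] cell (suc i) j
    shift = ∑-cong N λ i → ∑-cong M λ j →
      cong (λ r → ⟦ suc j ≤ rowLen qs (suc i) ⟧ * 𝟙 (P? (r , suc j))) (+-suc i k)

length≤sum : ∀ {ps} → All (1 ≤_) ps → length ps ≤ sum ps
length≤sum []           = z≤n
length≤sum (p>0 ∷ ps>0) = +-mono-≤ p>0 (length≤sum ps>0)

parts≤sum : ∀ ps → All (_≤ sum ps) ps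
parts≤sum []       = []
parts≤sum (p ∷ ps) = m≤m+n p (sum ps) ∷ All.map (λ q≤Σ → ≤-trans q≤Σ (m≤n+m (sum ps) p)) (parts≤sum ps)

-- Off the diagram hookLength is meaningless; the first factor discards those cells.
evenHookCell : List ℕ → ℕ → ℕ → ℕ
evenHookCell ps i j = ⟦ j ≤ rowLen ps i ⟧ * 𝟙 (hookLength ps i j % 2 ≟ 0)

evenHooks-∑∑ : ∀ {n ps} → IsPartition n ps → evenHooks ps ≡ ∑[ i < n ] ∑[ j < n ] evenHookCell ps (suc i) (suc j)
evenHooks-∑∑ {ps = ps} (ps>0 , _ , refl) =
  trans (length-filter-cellsFrom (λ c → hookLength ps (proj₁ c) (proj₂ c) % 2 ≟ 0) 1 ps (sum ps) (sum ps)
                                 (length≤sum ps>0) (parts≤sum ps))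
        (∑-cong (sum ps) λ i → ∑-cong (sum ps) λ j →
          cong (λ r → ⟦ suc j ≤ rowLen ps (suc i) ⟧ * 𝟙 (hookLength ps r (suc j) % 2 ≟ 0)) (+-comm i 1))

evenHookCell-conjugate : ∀ {ps} → Linked _≥_ ps → ∀ i j →
                         evenHookCell (conjugate ps) (suc i) (suc j) ≡ evenHookCell ps (suc j) (suc i)
evenHookCell-conjugate ps↓ i j =
  cong₂ _*_ (trans (cong (λ r → ⟦ suc j ≤ r ⟧) (rowLen-conjugate ps↓ i)) (⟦≤⟧-cong (≤colLen⇔≤rowLen ps↓ i j)))
            (cong (λ h → 𝟙 (h % 2 ≟ 0)) (hookLength-conjugate ps↓ i j))

evenHooks-conjugate : ∀ {n ps} → IsPartition n ps → evenHooks (conjugate ps) ≡ evenHooks ps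
evenHooks-conjugate {n} {ps} P@(_ , ps↓ , _) = begin
  evenHooks (conjugate ps)                                             ≡⟨ evenHooks-∑∑ (conjugate-isPartition P) ⟩
  ∑[ i < n ] ∑[ j < n ] evenHookCell (conjugate ps) (suc i) (suc j)    ≡⟨ ∑-cong n (∑-cong n ∘ evenHookCell-conjugate ps↓) ⟩
  ∑[ i < n ] ∑[ j < n ] evenHookCell ps (suc j) (suc i)                ≡⟨ ∑-swap n n (λ i j → evenHookCell ps (suc j) (suc i)) ⟩
  ∑[ j < n ] ∑[ i < n ] evenHookCell ps (suc j) (suc i)                ≡⟨ evenHooks-∑∑ P ⟨
  evenHooks ps                                                         ∎
  where open ≡-Reasoning

evenHooks-selfConjugate : ∀ {n ps} → IsPartition n ps → conjugate ps ≡ ps → 2 ∣ evenHooks ps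
evenHooks-selfConjugate {n} {ps} P@(_ , ps↓ , _) self =
  subst (2 ∣_) (sym (evenHooks-∑∑ P)) (∑∑-symmetric-even n (λ i j → evenHookCell ps (suc i) (suc j)) symmetric diagonal)
  where
  symmetric : ∀ i j → evenHookCell ps (suc i) (suc j) ≡ evenHookCell ps (suc j) (suc i)
  symmetric i j = trans (cong (λ qs → evenHookCell qs (suc i) (suc j)) (sym self)) (evenHookCell-conjugate ps↓ i j)
  rowLen≡colLen : ∀ i → rowLen ps (suc i) ≡ colLen ps (suc i)
  rowLen≡colLen i = trans (cong (λ qs → rowLen qs (suc i)) (sym self)) (rowLen-conjugate ps↓ i)
  diagonalHook-odd : ∀ i → hookLength ps (suc i) (suc i) % 2 ≢ 0
  diagonalHook-odd i rewrite rowLen≡colLen i = λ even → 0≢1+n (trans (sym even) (1+n+n%2≡1 (colLen ps (suc i) ∸ suc i)))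
  diagonal : ∀ i → evenHookCell ps (suc i) (suc i) ≡ 0
  diagonal i = trans (cong (⟦ suc i ≤ rowLen ps (suc i) ⟧ *_) (𝟙-no (hookLength ps (suc i) (suc i) % 2 ≟ 0) (diagonalHook-odd i)))
                     (*-zeroʳ ⟦ suc i ≤ rowLen ps (suc i) ⟧)

corollary3p3 : (n : ℕ) (L : List (List ℕ)) →
    Unique L → (∀ ps → ps ∈ L ⇔ IsPartition n ps) →
    isEven (countOddEvenHooks L)
corollary3p3 n L L! L⇔ =
  n∣m⇒m%n≡0 _ 2 (fixedPointFreeInvolution⇒2∣length (≡-dec _≟_) conjugate oddOnes (filter⁺ Odd? L!) pairing)
  where
  Odd? : Decidable (λ ps → evenHooks ps % 2 ≡ 1)
  Odd? ps = evenHooks ps % 2 ≟ 1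
  oddOnes : List (List ℕ)
  oddOnes = filter Odd? L
  member : ∀ {ps} → ps ∈ oddOnes → IsPartition n ps × evenHooks ps % 2 ≡ 1
  member ps∈ = let ps∈L , odd = ∈-filter⁻ Odd? ps∈ in Equivalence.to (L⇔ _) ps∈L , odd
  pairing : IsFixedPointFreeInvolutionOn conjugate oddOnes
  pairing = record
    { closed         = λ ps∈ → let P , odd = member ps∈ in
        ∈-filter⁺ Odd? (Equivalence.from (L⇔ _) (conjugate-isPartition P))
                       (trans (cong (_% 2) (evenHooks-conjugate P)) odd)
    ; involutive     = conjugate-involutive ∘ proj₁ ∘ member
    ; fixedPointFree = λ ps∈ self → let P , odd = member ps∈ in
        0≢1+n (trans (sym (n∣m⇒m%n≡0 _ 2 (evenHooks-selfConjugate P self))) odd)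
    }
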